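{- For every quinary signed-digit encoding $\gamma:\mathbb{N}\to\{ -2,-1,0,1,2\}$, we have $\langle\!\langle\mathrm{div2}(\gamma)\rangle\!\rangle=M(n\mapsto\mathrm{half}(\gamma_n))$ in the interval object $\mathbb{I}$.
   Context: Work in constructive type theory with function extensionality. An interval object is a set $\mathbb{I}$ with binary $\oplus$, $M:\mathbb{I}^{\mathbb{N}}\to\mathbb{I}$, points $-1,+1$, such that $\oplus$ is idempotent, commutative, transpositional ($(a\oplus b)\oplus(c\oplus d)=(a\oplus c)\oplus(b\oplus d)$) and cancellative; $M(\alpha)=\alpha_0\oplus M(\mathrm{tail}\,\alpha)$; if $\beta_i=\alpha_i\oplus\beta_{i+1}$ for all $i$ then $\beta_0=M(\alpha)$; and for every set $B$ with $\oplus_B,M_B,s,t$ satisfying these conditions there is a unique $h:\mathbb{I}\to B$ with $h(-1)=s$, $h(+1)=t$, $h(a\oplus b)=h(a)\oplus_B h(b)$. Fix one; $0:=-1\oplus+1$. $\langle\bar1\rangle=-1,\langle0\rangle=0,\langle1\rangle=+1$ for ternary digits $\{\bar1,0,1\}$; $\langle\!\langle\alpha\rangle\!\rangle:=M(n\mapsto\langle\alpha_n\rangle)$ for $\alpha:\mathbb{N}\to\{\bar1,0,1\}$. $\mathrm{half}(-2)=-1$, $\mathrm{half}(-1)=-1\oplus0$, $\mathrm{half}(0)=0$, $\mathrm{half}(1)=+1\oplus0$, $\mathrm{half}(2)=+1$. Define $d:\{ -2,\dots,2\}^2\to\{\bar1,0,1\}\times\{ -2,\dots,2\}$ by $d(-2,y)=(\bar1,y)$,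 $d(0,y)=(0,y)$, $d(2,y)=(1,y)$, $d(-1,-2)=(\bar1,0)$, $d(-1,-1)=(\bar1,1)$, $d(-1,0)=(0,-2)$, $d(-1,1)=(0,-1)$, $d(-1,2)=(0,0)$, $d(1,-2)=(0,0)$, $d(1,-1)=(0,1)$, $d(1,0)=(0,2)$, $d(1,1)=(1,-1)$, $d(1,2)=(1,0)$; then $\mathrm{div2}(\gamma)_0:=\pi_1 d(\gamma_0,\gamma_1)$ and $\mathrm{div2}(\gamma)_{n+1}:=\mathrm{div2}(\pi_2 d(\gamma_0,\gamma_1)::\mathrm{tail}(\mathrm{tail}\,\gamma))_n$. -}

module Defs where

open import Data.Nat using (ℕ; zero; suc)
open import Data.Product using (_×_; _,_; proj₁; proj₂; Σ)
open import Relation.Binary.PropositionalEquality using (_≡_)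

tail : {A : Set} → (ℕ → A) → (ℕ → A)
tail α n = α (suc n)

_::_ : {A : Set} → A → (ℕ → A) → (ℕ → A)
(a :: α) zero = a
(a :: α) (suc n) = α n

infixr 5 _::_

record IsConvexBody (B : Set) (_⊕_ : B → B → B) (M : (ℕ → B) → B) : Set where
  field
    idem     : ∀ a → (a ⊕ a) ≡ a
    comm     : ∀ a b → (a ⊕ b) ≡ (b ⊕ a)
    transp   : ∀ a b c d → ((a ⊕ b) ⊕ (c ⊕ d)) ≡ ((a ⊕ c) ⊕ (b ⊕ d))
    cancel   : ∀ a b c → (a ⊕ c) ≡ (b ⊕ c) → a ≡ b
    M-unfold : ∀ (α : ℕ → B) → M α ≡ (α 0 ⊕ M (tail α))
    M-canon  : ∀ (α β : ℕ → B) → (∀ i → β i ≡ (α i ⊕ β (suc i))) → β 0 ≡ M α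

record IntervalObject : Set₁ where
  field
    𝕀     : Set
    _⊕_   : 𝕀 → 𝕀 → 𝕀
    M     : (ℕ → 𝕀) → 𝕀
    -1ᵢ   : 𝕀
    +1ᵢ   : 𝕀
    isCB  : IsConvexBody 𝕀 _⊕_ M
    univ  : (B : Set) (_⊕B_ : B → B → B) (MB : (ℕ → B) → B) (s t : B) →
            IsConvexBody B _⊕B_ MB →
            Σ (𝕀 → B) λ h →
              (h -1ᵢ ≡ s) × (h +1ᵢ ≡ t) × (∀ a b → h (a ⊕ b) ≡ (h a ⊕B h b))
    univ-unique : (B : Set) (_⊕B_ : B → B → B) (MB : (ℕ → B) → B) (s t : B) →
            IsConvexBody B _⊕B_ MB →
            (h k : 𝕀 → B) →
            (h -1ᵢ ≡ s) → (h +1ᵢ ≡ t) → (∀ a b → h (a ⊕ b) ≡ (h a ⊕B h b)) →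
            (k -1ᵢ ≡ s) → (k +1ᵢ ≡ t) → (∀ a b → k (a ⊕ b) ≡ (k a ⊕B k b)) →
            ∀ x → h x ≡ k x

  0ᵢ : 𝕀
  0ᵢ = -1ᵢ ⊕ +1ᵢ

data 𝟛 : Set where
  d⁻ d0 d⁺ : 𝟛

data 𝟝 : Set where
  q-2 q-1 q0 q1 q2 : 𝟝

dmap : 𝟝 → 𝟝 → 𝟛 × 𝟝
dmap q-2 y   = d⁻ , y
dmap q0  y   = d0 , y
dmap q2  y   = d⁺ , y
dmap q-1 q-2 = d⁻ , q0
dmap q-1 q-1 = d⁻ , q1
dmap q-1 q0  = d0 , q-2
dmap q-1 q1  = d0 , q-1
dmap q-1 q2  = d0 , q0
dmap q1  q-2 = d0 , q0
dmap q1  q-1 = d0 , q1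
dmap q1  q0  = d0 , q2
dmap q1  q1  = d⁺ , q-1
dmap q1  q2  = d⁺ , q0

div2 : (ℕ → 𝟝) → (ℕ → 𝟛)
div2 γ zero    = proj₁ (dmap (γ 0) (γ 1))
div2 γ (suc n) = div2 (proj₂ (dmap (γ 0) (γ 1)) :: tail (tail γ)) n

module _ (I : IntervalObject) where
  open IntervalObject I

  ⟨_⟩ : 𝟛 → 𝕀
  ⟨ d⁻ ⟩ = -1ᵢ
  ⟨ d0 ⟩ = 0ᵢ
  ⟨ d⁺ ⟩ = +1ᵢ

  ⟪_⟫ : (ℕ → 𝟛) → 𝕀
  ⟪ α ⟫ = M (λ n → ⟨ α n ⟩)

  half : 𝟝 → 𝕀
  half q-2 = -1ᵢ
  half q-1 = -1ᵢ ⊕ 0ᵢ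
  half q0  = 0ᵢ
  half q1  = +1ᵢ ⊕ 0ᵢ
  half q2  = +1ᵢ

module Submission where

-- The digit table d rewrites two consecutive halved quinary digits into one
-- ternary digit followed by a halved carry: half a ⊕ (half b ⊕ m) equals
-- ⟨d₁⟩ ⊕ (half d₂ ⊕ m) for every m, an identity of midpoint algebra.  Applying
-- it inside M(half ∘ γ) peels off the first output digit of div2 and leaves
-- M(half ∘ γ′) for the carried sequence γ′, on which div2 recurses.  The values
-- M(half ∘ ·) along this recursion therefore satisfy β i = ⟨div2 γ i⟩ ⊕ β (i+1),
-- and the canonicity of M identifies β 0 with ⟪div2 γ⟫.

open import Defs
open import Algebra.Core using (Op₂)
open import Algebra.Definitions using (Idempotent; Commutative; Medial; _DistributesOverˡ_)
open import Data.Nat using (ℕ; zero; suc)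
open import Data.Product using (proj₁; proj₂)
open import Function using (_∘_)
open import Relation.Binary.PropositionalEquality

module MidpointAlgebra {A : Set} {_⊕_ : Op₂ A}
                       (idem : Idempotent _≡_ _⊕_)
                       (comm : Commutative _≡_ _⊕_)
                       (medial : Medial _≡_ _⊕_) where
  open ≡-Reasoning

  ⊕-distribˡ-⊕ : _DistributesOverˡ_ _≡_ _⊕_ _⊕_
  ⊕-distribˡ-⊕ a b c = begin
    a ⊕ (b ⊕ c)         ≡⟨ cong (_⊕ (b ⊕ c)) (idem a) ⟨
    (a ⊕ a) ⊕ (b ⊕ c)   ≡⟨ medial a a b c ⟩
    (a ⊕ b) ⊕ (a ⊕ c)   ∎

  -- For u = -1, v = +1, z = 0 these are the rows of the digit table d with first
  -- digit -1 (the second digit being u, u ⊕ z, z, v ⊕ z, v); exchanging u and v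
  -- gives the rows with first digit +1.
  module Carry (u v z : A) (z≡u⊕v : z ≡ u ⊕ v) where

    near-⊕-farQuarter : u ⊕ (v ⊕ z) ≡ z ⊕ (u ⊕ z)
    near-⊕-farQuarter = trans (⊕-distribˡ-⊕ u v z) (cong (_⊕ (u ⊕ z)) (sym z≡u⊕v))

    carry-near : ∀ m → (u ⊕ z) ⊕ (u ⊕ m) ≡ u ⊕ (z ⊕ m)
    carry-near m = sym (⊕-distribˡ-⊕ u z m)

    carry-nearQuarter : ∀ m → (u ⊕ z) ⊕ ((u ⊕ z) ⊕ m) ≡ u ⊕ ((v ⊕ z) ⊕ m)
    carry-nearQuarter m = sym (begin
      u ⊕ ((v ⊕ z) ⊕ m)         ≡⟨ ⊕-distribˡ-⊕ u (v ⊕ z) m ⟩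
      (u ⊕ (v ⊕ z)) ⊕ (u ⊕ m)   ≡⟨ cong (_⊕ (u ⊕ m)) near-⊕-farQuarter ⟩
      (z ⊕ (u ⊕ z)) ⊕ (u ⊕ m)   ≡⟨ medial z (u ⊕ z) u m ⟩
      (z ⊕ u) ⊕ ((u ⊕ z) ⊕ m)   ≡⟨ cong (_⊕ ((u ⊕ z) ⊕ m)) (comm z u) ⟩
      (u ⊕ z) ⊕ ((u ⊕ z) ⊕ m)   ∎)

    carry-mid : ∀ m → (u ⊕ z) ⊕ (z ⊕ m) ≡ z ⊕ (u ⊕ m)
    carry-mid m = trans (cong (_⊕ (z ⊕ m)) (comm u z)) (sym (⊕-distribˡ-⊕ z u m))

    carry-farQuarter : ∀ m → (u ⊕ z) ⊕ ((v ⊕ z) ⊕ m) ≡ z ⊕ ((u ⊕ z) ⊕ m)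
    carry-farQuarter m = begin
      (u ⊕ z) ⊕ ((v ⊕ z) ⊕ m)   ≡⟨ medial u z (v ⊕ z) m ⟩
      (u ⊕ (v ⊕ z)) ⊕ (z ⊕ m)   ≡⟨ cong (_⊕ (z ⊕ m)) near-⊕-farQuarter ⟩
      (z ⊕ (u ⊕ z)) ⊕ (z ⊕ m)   ≡⟨ ⊕-distribˡ-⊕ z (u ⊕ z) m ⟨
      z ⊕ ((u ⊕ z) ⊕ m)         ∎

    carry-far : ∀ m → (u ⊕ z) ⊕ (v ⊕ m) ≡ z ⊕ (z ⊕ m)
    carry-far m = trans (medial u z v m) (cong (_⊕ (z ⊕ m)) (sym z≡u⊕v))

leadingDigit : (ℕ → 𝟝) → 𝟛
leadingDigit γ = proj₁ (dmap (γ 0) (γ 1))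

carry : (ℕ → 𝟝) → (ℕ → 𝟝)
carry γ = proj₂ (dmap (γ 0) (γ 1)) :: tail (tail γ)

remainder : (ℕ → 𝟝) → ℕ → (ℕ → 𝟝)
remainder γ zero    = γ
remainder γ (suc i) = remainder (carry γ) i

module _ (I : IntervalObject) where
  open IntervalObject I
  open IsConvexBody isCB
  open MidpointAlgebra idem comm transp
  open ≡-Reasoning

  module Negative = Carry -1ᵢ +1ᵢ 0ᵢ refl
  module Positive = Carry +1ᵢ -1ᵢ 0ᵢ (comm -1ᵢ +1ᵢ)

  half-dmap : ∀ a b m → half I a ⊕ (half I b ⊕ m)
                      ≡ ⟨_⟩ I (proj₁ (dmap a b)) ⊕ (half I (proj₂ (dmap a b)) ⊕ m)
  half-dmap q-2 b   m = refl
  half-dmap q0  b   m = refl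
  half-dmap q2  b   m = refl
  half-dmap q-1 q-2 m = Negative.carry-near m
  half-dmap q-1 q-1 m = Negative.carry-nearQuarter m
  half-dmap q-1 q0  m = Negative.carry-mid m
  half-dmap q-1 q1  m = Negative.carry-farQuarter m
  half-dmap q-1 q2  m = Negative.carry-far m
  half-dmap q1  q-2 m = Positive.carry-far m
  half-dmap q1  q-1 m = Positive.carry-farQuarter m
  half-dmap q1  q0  m = Positive.carry-mid m
  half-dmap q1  q1  m = Positive.carry-nearQuarter m
  half-dmap q1  q2  m = Positive.carry-near m

  M-half-carry : ∀ γ → M (half I ∘ γ) ≡ ⟨_⟩ I (leadingDigit γ) ⊕ M (half I ∘ carry γ)
  M-half-carry γ = begin
    M (half I ∘ γ)
      ≡⟨ M-unfold _ ⟩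
    half I (γ 0) ⊕ M (half I ∘ tail γ)
      ≡⟨ cong (half I (γ 0) ⊕_) (M-unfold _) ⟩
    half I (γ 0) ⊕ (half I (γ 1) ⊕ M (half I ∘ tail (tail γ)))
      ≡⟨ half-dmap (γ 0) (γ 1) _ ⟩
    ⟨_⟩ I (leadingDigit γ) ⊕ (half I (carry γ 0) ⊕ M (half I ∘ tail (tail γ)))
      ≡⟨ cong (⟨_⟩ I (leadingDigit γ) ⊕_) (M-unfold _) ⟨
    ⟨_⟩ I (leadingDigit γ) ⊕ M (half I ∘ carry γ)
      ∎

  M-half-remainder : ∀ γ i → M (half I ∘ remainder γ i)
                           ≡ ⟨_⟩ I (div2 γ i) ⊕ M (half I ∘ remainder γ (suc i))
  M-half-remainder γ zero    = M-half-carry γ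
  M-half-remainder γ (suc i) = M-half-remainder (carry γ) i

  ⟪div2⟫≡M-half : ∀ γ → ⟪_⟫ I (div2 γ) ≡ M (half I ∘ γ)
  ⟪div2⟫≡M-half γ =
    sym (M-canon (⟨_⟩ I ∘ div2 γ) (λ i → M (half I ∘ remainder γ i)) (M-half-remainder γ))

lemma5p64 : (I : IntervalObject) (γ : ℕ → 𝟝) →
    ⟪_⟫ I (div2 γ) ≡ IntervalObject.M I (λ n → half I (γ n))
lemma5p64 = ⟪div2⟫≡M-half
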